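{- Let $p_1 < p_2$ be odd primes, let $a$ be an integer, let $b, c, d$ be three pairwise distinct residues modulo $p_2$, and let $\alpha_1 \geq 1$, $\alpha_2 \geq 1$ be integers. Then there exist integers $a_{p_1^i p_2^j}$ for $1 \leq i \leq \alpha_1$, $1 \leq j \leq \alpha_2$, such that the set of congruences $A = \{a_{p_1^i p_2^j} \pmod{p_1^i p_2^j} : 1 \leq i \leq \alpha_1, 1 \leq j \leq \alpha_2\}$ is good, and for all such $i,j$ we have $a_{p_1^i p_2^j} \equiv a \pmod{p_1}$ and $a_{p_1^i p_2^j} \bmod p_2 \in \{b, c, d\}$.
   Context: Two congruences $a \pmod{b}$ and $a' \pmod{b'}$ overlap if there is an integer $x$ with $x \equiv a \pmod{b}$ and $x \equiv a' \pmod{b'}$. A finite set of congruences $\{a_1 \pmod{d_1}, \ldots, a_t \pmod{d_t}\}$ with pairwise distinct moduli $1 \leq d_1 < \cdots < d_t$ is called good if whenever two distinct congruences $a_i \pmod{d_i}$ and $a_j \pmod{d_j}$ of the set overlap, we have $\gcd(d_i,d_j)=1$. -}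

module Defs where

open import Data.Nat as ℕ using (ℕ; _≤_; _^_; _*_)
open import Data.Nat.GCD using (gcd)
open import Data.Integer as ℤ using (ℤ; +_; _-_)
open import Data.Integer.Divisibility using () renaming (_∣_ to _∣ℤ_)
open import Data.Product using (_×_; ∃)
open import Data.Empty using (⊥)
open import Relation.Binary.PropositionalEquality using (_≡_)

_≡_[mod_] : ℤ → ℤ → ℕ → Set
x ≡ a [mod m ] = (+ m) ∣ℤ (x - a)

Overlap : ℤ → ℕ → ℤ → ℕ → Set
Overlap a b a' b' = ∃ λ (x : ℤ) → (x ≡ a [mod b ]) × (x ≡ a' [mod b' ])

InRange : ℕ → ℕ → Set
InRange α i = (1 ≤ i) × (i ≤ α)

GoodFamily : ℕ → ℕ → ℕ → ℕ → (ℕ → ℕ → ℤ) → Set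
GoodFamily p₁ p₂ α₁ α₂ A =
  ∀ i j i' j' → InRange α₁ i → InRange α₂ j → InRange α₁ i' → InRange α₂ j' →
  (p₁ ^ i * p₂ ^ j ≡ p₁ ^ i' * p₂ ^ j' → ⊥) →
  Overlap (A i j) (p₁ ^ i * p₂ ^ j) (A i' j') (p₁ ^ i' * p₂ ^ j') →
  gcd (p₁ ^ i * p₂ ^ j) (p₁ ^ i' * p₂ ^ j') ≡ 1

{-# OPTIONS --safe #-}
-- Every modulus p₁^i p₂^j is divisible by p₁ p₂, so goodness means that no two of the
-- congruences overlap: for distinct (i, j) and (i', j') the residues must differ modulo
-- p₁^min(i,i') or modulo p₂^min(j,j').  By the Chinese remainder theorem a residue can be
-- prescribed independently modulo p₁^α₁ and modulo p₂^α₂.  Modulo p₁^α₁ take a in row 1 and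
-- a + p₁^(i-1) in row i ≥ 2: two distinct rows i, i' ≥ 2 then differ in their p₁-adic digit
-- of place min(i,i') - 1.  Modulo p₂^α₂ take b, c + p₂, c + p₂², … along row 1 and
-- d, c + 2p₂, c + 2p₂², … along every other row; two such values either have different
-- residues among b, c, d modulo p₂, or first differ in the p₂-adic digit of place
-- min(j,j') - 1, the digits 1 and 2 being nonzero modulo p₂ > 2.
module Submission where

open import Defs
open import Data.Nat as ℕ using (ℕ; zero; suc; z≤n; s≤s; _<_; _≤_; _^_; _*_; _⊓_; NonZero)
import Data.Nat.Properties as ℕ
open import Data.Nat.Divisibility as ℕ using (_∣_; ∣-trans; m∣m*n; n∣m*n; *-pres-∣)
open import Data.Nat.Coprimality as Coprimality
  using (Coprime; coprime-Bézout; coprime-divisor; 1-coprimeTo; prime⇒coprime)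
open import Data.Nat.GCD using (module Bézout)
open import Data.Nat.Primality using (Prime; prime⇒nonZero)
open import Data.Integer as ℤ using (ℤ; +_; _-_; 1ℤ) renaming (_+_ to _+ℤ_; _*_ to _*ℤ_)
import Data.Integer.Properties as ℤ
import Data.Integer.Divisibility.Signed as Signed
open import Data.Integer.Tactic.RingSolver using (solve-∀)
open import Data.Bool using (Bool; true; false)
open import Data.Product using (_×_; ∃; _,_; proj₁; proj₂; map₂; swap; uncurry)
open import Data.Sum as Sum using (_⊎_; inj₁; inj₂)
open import Data.Empty using (⊥-elim)
open import Function using (_∘_)
open import Level using (0ℓ)
open import Relation.Binary.Bundles using (Setoid)
open import Relation.Binary.Definitions using (tri<; tri≈; tri>)
open import Relation.Binary.PropositionalEquality using (_≡_; _≢_; refl; sym; cong; subst)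
import Relation.Binary.Reasoning.Setoid as SetoidReasoning
open import Relation.Nullary using (¬_; yes; no; contradiction)

^-monoʳ-∣ : ∀ p {m n} → m ≤ n → p ^ m ∣ p ^ n
^-monoʳ-∣ p z≤n       = ℕ.1∣ _
^-monoʳ-∣ p (s≤s m≤n) = ℕ.*-monoʳ-∣ p (^-monoʳ-∣ p m≤n)

p∣p^n : ∀ p {n} → 1 ≤ n → p ∣ p ^ n
p∣p^n p (s≤s _) = m∣m*n _

∣∧<⇒≡0 : ∀ {q k} → q ∣ k → k < q → k ≡ 0
∣∧<⇒≡0 {k = zero}  _   _   = refl
∣∧<⇒≡0 {k = suc _} q∣k k<q = contradiction (ℕ.∣⇒≤ q∣k) (ℕ.<⇒≱ k<q)

coprime-*ʳ : ∀ {m n o} → Coprime m n → Coprime m o → Coprime m (n * o)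
coprime-*ʳ {n = n} m⊥n m⊥o (d∣m , d∣no) = m⊥o (d∣m , coprime-divisor d⊥n d∣no)
  where
  d⊥n : Coprime _ n
  d⊥n (e∣d , e∣n) = m⊥n (∣-trans e∣d d∣m , e∣n)

coprime-^ʳ : ∀ {m n} → Coprime m n → ∀ k → Coprime m (n ^ k)
coprime-^ʳ {m} m⊥n zero    = Coprimality.sym (1-coprimeTo m)
coprime-^ʳ     m⊥n (suc k) = coprime-*ʳ m⊥n (coprime-^ʳ m⊥n k)

coprime-^ : ∀ {m n} → Coprime m n → ∀ k l → Coprime (m ^ k) (n ^ l)
coprime-^ m⊥n k l = Coprimality.sym (coprime-^ʳ (Coprimality.sym (coprime-^ʳ m⊥n l)) k)

-- x ≡ y [mod m] unfolds to m ∣ ℤ.∣ x - y ∣, from which Agda cannot recover x and y; hence the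
-- explicit integer arguments below, and chains of congruences are written with ≡-mod-Reasoning.
≡-mod-refl : ∀ {m} x → x ≡ x [mod m ]
≡-mod-refl x = subst (λ t → _ ∣ ℤ.∣ t ∣) (sym (ℤ.+-inverseʳ x)) (ℕ._∣0 _)

≡-mod-sym : ∀ {m} x y → x ≡ y [mod m ] → y ≡ x [mod m ]
≡-mod-sym x y = subst (_ ∣_) (ℤ.∣i-j∣≡∣j-i∣ x y)

≡-mod-trans : ∀ {m} x y z → x ≡ y [mod m ] → y ≡ z [mod m ] → x ≡ z [mod m ]
≡-mod-trans {m} x y z x≡y y≡z = Signed.∣⇒∣ᵤ (subst (+ m Signed.∣_) (ℤ.+-minus-telescope x y z)
  (Signed.∣m∣n⇒∣m+n (Signed.∣ᵤ⇒∣ {+ m} {x - y} x≡y) (Signed.∣ᵤ⇒∣ {+ m} {y - z} y≡z)))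

≡-mod-setoid : ℕ → Setoid 0ℓ 0ℓ
≡-mod-setoid m = record
  { _≈_           = λ x y → x ≡ y [mod m ]
  ; isEquivalence = record
    { refl  = λ {x} → ≡-mod-refl x
    ; sym   = λ {x} {y} → ≡-mod-sym x y
    ; trans = λ {x} {y} {z} → ≡-mod-trans x y z
    }
  }

module ≡-mod-Reasoning (m : ℕ) = SetoidReasoning (≡-mod-setoid m)

x+t-x≡t : ∀ (x t : ℤ) → (x +ℤ t) - x ≡ t
x+t-x≡t = solve-∀

m∣t⇒x+t≡x : ∀ {m t} x → m ∣ t → (x +ℤ + t) ≡ x [mod m ]
m∣t⇒x+t≡x {t = t} x = subst (λ s → _ ∣ ℤ.∣ s ∣) (sym (x+t-x≡t x (+ t)))

x+πⁿu≢x : ∀ {π u} .{{_ : NonZero π}} n x → ¬ π ∣ u → ¬ (x +ℤ + (π ^ n * u)) ≡ x [mod π ^ suc n ]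
x+πⁿu≢x {π} {u} n x π∤u h = π∤u (ℕ.*-cancelˡ-∣ (π ^ n) {{ℕ.m^n≢0 π n}} πⁿπ∣πⁿu)
  where
  πⁿπ∣πⁿu : π ^ n * π ∣ π ^ n * u
  πⁿπ∣πⁿu = subst (_∣ π ^ n * u) (ℕ.*-comm π (π ^ n)) (subst (λ s → _ ∣ ℤ.∣ s ∣) (x+t-x≡t x _) h)

≡-mod-residue⇒≡ : ∀ {q r s} → r < q → s < q → (+ r) ≡ (+ s) [mod q ] → r ≡ s
≡-mod-residue⇒≡ {q} {r} {s} r<q s<q q∣r-s =
  ℤ.+-injective (ℤ.i-j≡0⇒i≡j (+ r) (+ s) (ℤ.∣i∣≡0⇒i≡0 (∣∧<⇒≡0 q∣r-s ∣r-s∣<q)))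
  where
  open ℕ.≤-Reasoning
  ∣r-s∣<q : ℤ.∣ + r - + s ∣ < q
  ∣r-s∣<q = begin-strict
    ℤ.∣ + r - + s ∣ ≡⟨ cong ℤ.∣_∣ (ℤ.m-n≡m⊖n r s) ⟩
    ℤ.∣ r ℤ.⊖ s ∣   ≤⟨ ℤ.∣m⊝n∣≤m⊔n r s ⟩
    r ℕ.⊔ s         <⟨ ℕ.⊔-lub r<q s<q ⟩
    q               ∎

overlap⇒≡-mod : ∀ {d m n} x y → d ∣ m → d ∣ n → Overlap x m y n → x ≡ y [mod d ]
overlap⇒≡-mod {d} x y d∣m d∣n (z , z≡x , z≡y) = begin
  x ≈⟨ ∣-trans d∣m z≡x ⟨
  z ≈⟨ ∣-trans d∣n z≡y ⟩
  y ∎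
  where open ≡-mod-Reasoning d

crt-from-basis : ∀ {m n} e → (+ m) Signed.∣ e → (+ n) Signed.∣ (e - 1ℤ) →
                 ∀ u v → ∃ λ x → x ≡ u [mod m ] × x ≡ v [mod n ]
crt-from-basis {m} {n} e m∣e n∣e-1 u v =
  x , Signed.∣⇒∣ᵤ (subst (+ m Signed.∣_) (sym (x-u u v e)) (Signed.∣n⇒∣m*n (v - u) m∣e))
    , Signed.∣⇒∣ᵤ (subst (+ n Signed.∣_) (sym (x-v u v e)) (Signed.∣n⇒∣m*n (v - u) n∣e-1))
  where
  x : ℤ
  x = u +ℤ (v - u) *ℤ e
  x-u : ∀ u v e → (u +ℤ (v - u) *ℤ e) - u ≡ (v - u) *ℤ e
  x-u = solve-∀
  x-v : ∀ u v e → (u +ℤ (v - u) *ℤ e) - v ≡ (v - u) *ℤ (e - 1ℤ)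
  x-v = solve-∀

bézout-basis : ∀ {m n} x y → 1 ℕ.+ y * n ≡ x * m →
               (+ m) Signed.∣ + (x * m) × (+ n) Signed.∣ (+ (x * m) - 1ℤ)
bézout-basis x y 1+yn≡xm =
  Signed.∣ᵤ⇒∣ (n∣m*n x) , subst (_ Signed.∣_) (cong (λ t → + t - 1ℤ) 1+yn≡xm) (Signed.∣ᵤ⇒∣ (n∣m*n y))

crt : ∀ {m n} → Coprime m n → ∀ u v → ∃ λ x → x ≡ u [mod m ] × x ≡ v [mod n ]
crt {m} {n} m⊥n u v with coprime-Bézout m⊥n
... | Bézout.+- x y eq = uncurry (crt-from-basis (+ (x * m))) (bézout-basis x y eq) u v
... | Bézout.-+ x y eq = map₂ swap (uncurry (crt-from-basis (+ (y * n))) (bézout-basis y x eq) v u)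

module Rows {p : ℕ} (1<p : 1 < p) (a : ℤ) where

  private instance
    p≢0 : NonZero p
    p≢0 = ℕ.>-nonZero (ℕ.<-trans (s≤s z≤n) 1<p)

  row : ℕ → ℤ
  row (suc (suc k)) = a +ℤ + (p ^ suc k)
  row _             = a

  row≡a : ∀ i → row i ≡ a [mod p ]
  row≡a (suc (suc k)) = m∣t⇒x+t≡x a (m∣m*n _)
  row≡a (suc zero)    = ≡-mod-refl a
  row≡a zero          = ≡-mod-refl a

  row-apart-< : ∀ {k k'} → k < k' → ¬ row (suc (suc k)) ≡ row (suc (suc k')) [mod p ^ suc (suc k) ]
  row-apart-< {k} {k'} k<k' h = x+πⁿu≢x (suc k) a (ℕ.>⇒∤ 1<p) (begin
    a +ℤ + (p ^ suc k * 1) ≡⟨ cong (λ t → a +ℤ + t) (ℕ.*-identityʳ _) ⟩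
    row (suc (suc k))      ≈⟨ h ⟩
    row (suc (suc k'))     ≈⟨ m∣t⇒x+t≡x a (^-monoʳ-∣ p (s≤s k<k')) ⟩
    a                      ∎)
    where open ≡-mod-Reasoning (p ^ suc (suc k))

  row-apart : ∀ {k k'} → k ≢ k' →
              ¬ row (suc (suc k)) ≡ row (suc (suc k')) [mod p ^ (suc (suc k) ⊓ suc (suc k')) ]
  row-apart {k} {k'} k≢k' with ℕ.<-cmp k k'
  ... | tri< k<k' _ _ rewrite ℕ.m≤n⇒m⊓n≡m (ℕ.<⇒≤ k<k') = row-apart-< k<k'
  ... | tri≈ _ k≡k' _ = contradiction k≡k' k≢k'
  ... | tri> _ _ k'<k rewrite ℕ.m≥n⇒m⊓n≡n (ℕ.<⇒≤ k'<k) =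
    row-apart-< k'<k ∘ ≡-mod-sym (row (suc (suc k))) (row (suc (suc k')))

module Columns {q : ℕ} (2<q : 2 < q) {b c d : ℕ} (b<q : b < q) (c<q : c < q) (d<q : d < q)
               (b≢c : b ≢ c) (b≢d : b ≢ d) (c≢d : c ≢ d) where

  private instance
    q≢0 : NonZero q
    q≢0 = ℕ.>-nonZero (ℕ.<-trans (s≤s z≤n) 2<q)

  weight : Bool → ℕ
  weight true  = 1
  weight false = 2

  q∤weight : ∀ r → ¬ q ∣ weight r
  q∤weight true  = ℕ.>⇒∤ (ℕ.<-trans (ℕ.n<1+n 1) 2<q)
  q∤weight false = ℕ.>⇒∤ 2<q

  column : Bool → ℕ → ℤ
  column r     (suc (suc k)) = + c +ℤ + (q ^ suc k * weight r)
  column true  (suc zero)    = + b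
  column false (suc zero)    = + d
  column _     zero          = + c

  residue : Bool → ℕ → ℕ
  residue _     (suc (suc _)) = c
  residue true  (suc zero)    = b
  residue false (suc zero)    = d
  residue _     zero          = c

  residue<q : ∀ r j → residue r j < q
  residue<q _     (suc (suc _)) = c<q
  residue<q true  (suc zero)    = b<q
  residue<q false (suc zero)    = d<q
  residue<q _     zero          = c<q

  residue∈bcd : ∀ r j → residue r j ≡ b ⊎ residue r j ≡ c ⊎ residue r j ≡ d
  residue∈bcd _     (suc (suc _)) = inj₂ (inj₁ refl)
  residue∈bcd true  (suc zero)    = inj₁ refl
  residue∈bcd false (suc zero)    = inj₂ (inj₂ refl)
  residue∈bcd _     zero          = inj₂ (inj₁ refl)

  column≡residue : ∀ r j → column r j ≡ + residue r j [mod q ]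
  column≡residue _     (suc (suc _)) = m∣t⇒x+t≡x (+ c) (∣-trans (m∣m*n _) (m∣m*n _))
  column≡residue true  (suc zero)    = ≡-mod-refl (+ b)
  column≡residue false (suc zero)    = ≡-mod-refl (+ d)
  column≡residue _     zero          = ≡-mod-refl (+ c)

  residue-apart : ∀ {r r' j'} → (r , 1) ≢ (r' , j') → residue r 1 ≢ residue r' j'
  residue-apart {true}  {true}  {suc zero}    ne = contradiction refl ne
  residue-apart {true}  {false} {suc zero}    _  = b≢d
  residue-apart {false} {true}  {suc zero}    _  = b≢d ∘ sym
  residue-apart {false} {false} {suc zero}    ne = contradiction refl ne
  residue-apart {true}  {_}     {suc (suc _)} _  = b≢c
  residue-apart {false} {_}     {suc (suc _)} _  = c≢d ∘ sym
  residue-apart {true}  {_}     {zero}        _  = b≢c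
  residue-apart {false} {_}     {zero}        _  = c≢d ∘ sym

  column-true≢column-false : ∀ k →
    ¬ column true (suc (suc k)) ≡ column false (suc (suc k)) [mod q ^ suc (suc k) ]
  column-true≢column-false k h = x+πⁿu≢x (suc k) (column true (suc (suc k))) (q∤weight true) (begin
    column true (suc (suc k)) +ℤ + t ≡⟨ ℤ.+-assoc (+ c) (+ t) (+ t) ⟩
    + c +ℤ + (t ℕ.+ t)                ≡⟨ cong (λ s → + c +ℤ + s) (ℕ.*-distribˡ-+ (q ^ suc k) 1 1) ⟨
    column false (suc (suc k))        ≈⟨ h ⟨
    column true (suc (suc k))         ∎)
    where
    open ≡-mod-Reasoning (q ^ suc (suc k))
    t : ℕ
    t = q ^ suc k * 1

  column-apart-≤ : ∀ {r r' j j'} → (r , j) ≢ (r' , j') → 1 ≤ j → j ≤ j' →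
                   ¬ column r j ≡ column r' j' [mod q ^ j ]
  column-apart-≤ {r} {r'} {suc zero} {j'} ne _ _ h = residue-apart ne
    (≡-mod-residue⇒≡ (residue<q r 1) (residue<q r' j') (begin
      + residue r 1   ≈⟨ column≡residue r 1 ⟨
      column r 1      ≈⟨ ∣-trans (m∣m*n 1) h ⟩
      column r' j'    ≈⟨ column≡residue r' j' ⟩
      + residue r' j' ∎))
    where open ≡-mod-Reasoning q
  column-apart-≤ {r} {r'} {suc (suc k)} {suc (suc k')} ne _ (s≤s (s≤s k≤k')) h
    with ℕ.m≤n⇒m<n∨m≡n k≤k'
  ... | inj₁ k<k' = x+πⁿu≢x (suc k) (+ c) (q∤weight r) (begin
      column r (suc (suc k))   ≈⟨ h ⟩
      column r' (suc (suc k')) ≈⟨ m∣t⇒x+t≡x (+ c) (∣-trans (^-monoʳ-∣ q (s≤s k<k')) (m∣m*n _)) ⟩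
      + c                      ∎)
    where open ≡-mod-Reasoning (q ^ suc (suc k))
  ... | inj₂ refl with r | r'
  ...   | true  | false = column-true≢column-false k h
  ...   | false | true  = column-true≢column-false k
                            (≡-mod-sym (column false (suc (suc k))) (column true (suc (suc k))) h)
  ...   | true  | true  = ne refl
  ...   | false | false = ne refl

  column-apart : ∀ {r r' j j'} → (r , j) ≢ (r' , j') → 1 ≤ j → 1 ≤ j' →
                 ¬ column r j ≡ column r' j' [mod q ^ (j ⊓ j') ]
  column-apart {r} {r'} {j} {j'} ne 1≤j 1≤j' with ℕ.≤-total j j'
  ... | inj₁ j≤j' rewrite ℕ.m≤n⇒m⊓n≡m j≤j' = column-apart-≤ ne 1≤j j≤j'
  ... | inj₂ j'≤j rewrite ℕ.m≥n⇒m⊓n≡n j'≤j =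
    column-apart-≤ (ne ∘ sym) 1≤j' j'≤j ∘ ≡-mod-sym (column r j) (column r' j')

module Construction
  {p₁ p₂ : ℕ} (p₁-prime : Prime p₁) (p₂-prime : Prime p₂) (2<p₁ : 2 < p₁) (p₁<p₂ : p₁ < p₂)
  (a : ℤ) {b c d : ℕ} (b<p₂ : b < p₂) (c<p₂ : c < p₂) (d<p₂ : d < p₂)
  (b≢c : b ≢ c) (b≢d : b ≢ d) (c≢d : c ≢ d)
  {α₁ α₂ : ℕ} (1≤α₁ : 1 ≤ α₁) (1≤α₂ : 1 ≤ α₂) where

  open Rows (ℕ.<-trans (ℕ.n<1+n 1) 2<p₁) a
  open Columns (ℕ.<-trans 2<p₁ p₁<p₂) b<p₂ c<p₂ d<p₂ b≢c b≢d c≢d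

  private instance
    p₁≢0 : NonZero p₁
    p₁≢0 = prime⇒nonZero p₁-prime

  firstRow : ℕ → Bool
  firstRow (suc zero) = true
  firstRow _          = false

  solution : ∀ i j → ∃ λ x → x ≡ row i [mod p₁ ^ α₁ ] × x ≡ column (firstRow i) j [mod p₂ ^ α₂ ]
  solution i j = crt (coprime-^ (Coprimality.sym (prime⇒coprime p₂-prime p₁<p₂)) α₁ α₂)
                     (row i) (column (firstRow i) j)

  A : ℕ → ℕ → ℤ
  A i j = proj₁ (solution i j)

  A≡row : ∀ i j → A i j ≡ row i [mod p₁ ^ α₁ ]
  A≡row i j = proj₁ (proj₂ (solution i j))

  A≡column : ∀ i j → A i j ≡ column (firstRow i) j [mod p₂ ^ α₂ ]
  A≡column i j = proj₂ (proj₂ (solution i j))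

  A≡a : ∀ i j → A i j ≡ a [mod p₁ ]
  A≡a i j = begin
    A i j ≈⟨ ∣-trans (p∣p^n p₁ 1≤α₁) (A≡row i j) ⟩
    row i ≈⟨ row≡a i ⟩
    a     ∎
    where open ≡-mod-Reasoning p₁

  A≡residue : ∀ i j → A i j ≡ + residue (firstRow i) j [mod p₂ ]
  A≡residue i j = begin
    A i j                    ≈⟨ ∣-trans (p∣p^n p₂ 1≤α₂) (A≡column i j) ⟩
    column (firstRow i) j    ≈⟨ column≡residue (firstRow i) j ⟩
    + residue (firstRow i) j ∎
    where open ≡-mod-Reasoning p₂

  A∈bcd : ∀ i j → (A i j ≡ + b [mod p₂ ]) ⊎ (A i j ≡ + c [mod p₂ ]) ⊎ (A i j ≡ + d [mod p₂ ])
  A∈bcd i j = Sum.map A≡ (Sum.map A≡ A≡) (residue∈bcd (firstRow i) j)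
    where
    A≡ : ∀ {s} → residue (firstRow i) j ≡ s → A i j ≡ + s [mod p₂ ]
    A≡ refl = A≡residue i j

  Overlapping : ℕ → ℕ → ℕ → ℕ → Set
  Overlapping i j i' j' = Overlap (A i j) (p₁ ^ i * p₂ ^ j) (A i' j') (p₁ ^ i' * p₂ ^ j')

  overlap⇒≡ : ∀ i j i' j' → Overlapping i j i' j' →
              A i j ≡ A i' j' [mod p₁ ^ (i ⊓ i') * p₂ ^ (j ⊓ j') ]
  overlap⇒≡ i j i' j' = overlap⇒≡-mod (A i j) (A i' j')
    (*-pres-∣ (^-monoʳ-∣ p₁ (ℕ.m⊓n≤m i i')) (^-monoʳ-∣ p₂ (ℕ.m⊓n≤m j j')))
    (*-pres-∣ (^-monoʳ-∣ p₁ (ℕ.m⊓n≤n i i')) (^-monoʳ-∣ p₂ (ℕ.m⊓n≤n j j')))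

  overlap⇒row≡ : ∀ i j i' j' → i ≤ α₁ → Overlapping i j i' j' →
                 row i ≡ row i' [mod p₁ ^ (i ⊓ i') ]
  overlap⇒row≡ i j i' j' i≤α₁ overlaps = begin
    row i   ≈⟨ ∣-trans d∣p₁^α₁ (A≡row i j) ⟨
    A i j   ≈⟨ ∣-trans (m∣m*n _) (overlap⇒≡ i j i' j' overlaps) ⟩
    A i' j' ≈⟨ ∣-trans d∣p₁^α₁ (A≡row i' j') ⟩
    row i'  ∎
    where
    open ≡-mod-Reasoning (p₁ ^ (i ⊓ i'))
    d∣p₁^α₁ : p₁ ^ (i ⊓ i') ∣ p₁ ^ α₁
    d∣p₁^α₁ = ^-monoʳ-∣ p₁ (ℕ.≤-trans (ℕ.m⊓n≤m i i') i≤α₁)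

  overlap⇒column≡ : ∀ i j i' j' → j ≤ α₂ → Overlapping i j i' j' →
                    column (firstRow i) j ≡ column (firstRow i') j' [mod p₂ ^ (j ⊓ j') ]
  overlap⇒column≡ i j i' j' j≤α₂ overlaps = begin
    column (firstRow i) j   ≈⟨ ∣-trans d∣p₂^α₂ (A≡column i j) ⟨
    A i j                   ≈⟨ ∣-trans (n∣m*n (p₁ ^ (i ⊓ i'))) (overlap⇒≡ i j i' j' overlaps) ⟩
    A i' j'                 ≈⟨ ∣-trans d∣p₂^α₂ (A≡column i' j') ⟩
    column (firstRow i') j' ∎
    where
    open ≡-mod-Reasoning (p₂ ^ (j ⊓ j'))
    d∣p₂^α₂ : p₂ ^ (j ⊓ j') ∣ p₂ ^ α₂
    d∣p₂^α₂ = ^-monoʳ-∣ p₂ (ℕ.≤-trans (ℕ.m⊓n≤m j j') j≤α₂)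

  apart : ∀ {i j i' j'} → (i , j) ≢ (i' , j') → 1 ≤ i → 1 ≤ i' → 1 ≤ j → 1 ≤ j' →
          row i ≡ row i' [mod p₁ ^ (i ⊓ i') ] →
          ¬ column (firstRow i) j ≡ column (firstRow i') j' [mod p₂ ^ (j ⊓ j') ]
  apart {suc zero}    {_} {suc zero}     ne _ _ 1≤j 1≤j' _ = column-apart (λ { refl → ne refl }) 1≤j 1≤j'
  apart {suc zero}    {_} {suc (suc _)}  _  _ _ 1≤j 1≤j' _ = column-apart (λ ()) 1≤j 1≤j'
  apart {suc (suc _)} {_} {suc zero}     _  _ _ 1≤j 1≤j' _ = column-apart (λ ()) 1≤j 1≤j'
  apart {suc (suc k)} {_} {suc (suc k')} ne _ _ 1≤j 1≤j' rows≡ with k ℕ.≟ k'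
  ... | yes refl = column-apart (λ { refl → ne refl }) 1≤j 1≤j'
  ... | no k≢k'  = contradiction rows≡ (row-apart k≢k')

  A-good : GoodFamily p₁ p₂ α₁ α₂ A
  A-good i j i' j' (1≤i , i≤α₁) (1≤j , j≤α₂) (1≤i' , _) (1≤j' , _) moduli≢ overlaps =
    ⊥-elim (apart (λ { refl → moduli≢ refl }) 1≤i 1≤i' 1≤j 1≤j'
      (overlap⇒row≡ i j i' j' i≤α₁ overlaps) (overlap⇒column≡ i j i' j' j≤α₂ overlaps))

lemma5 : (p₁ p₂ : ℕ) → Prime p₁ → Prime p₂ → 2 < p₁ → p₁ < p₂ →
    (a : ℤ) → (b c d : ℕ) → b < p₂ → c < p₂ → d < p₂ →
    b ≢ c → b ≢ d → c ≢ d →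
    (α₁ α₂ : ℕ) → 1 ≤ α₁ → 1 ≤ α₂ →
    ∃ λ (A : ℕ → ℕ → ℤ) →
      GoodFamily p₁ p₂ α₁ α₂ A ×
      (∀ i j → InRange α₁ i → InRange α₂ j →
        (A i j ≡ a [mod p₁ ]) ×
        ((A i j ≡ + b [mod p₂ ]) ⊎ (A i j ≡ + c [mod p₂ ]) ⊎ (A i j ≡ + d [mod p₂ ])))
lemma5 p₁ p₂ p₁-prime p₂-prime 2<p₁ p₁<p₂ a b c d b<p₂ c<p₂ d<p₂ b≢c b≢d c≢d α₁ α₂ 1≤α₁ 1≤α₂ =
  A , A-good , λ i j _ _ → A≡a i j , A∈bcd i j
  where
  open Construction p₁-prime p₂-prime 2<p₁ p₁<p₂ a b<p₂ c<p₂ d<p₂ b≢c b≢d c≢d 1≤α₁ 1≤α₂
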